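{- Let $\alpha:X\rightharpoonup\wp(Y)$ and $\beta:Y\rightharpoonup\wp(Z)$ be relations and let $g:Z\rightharpoonup\wp(W)$ be a partial function. Then $(\alpha*\beta)*g=\alpha*(\beta*g)$.
   Context: Relations $\alpha:X\rightharpoonup Y$ are subsets of $X\times Y$ (sets with the axiom of choice); juxtaposition is relational composition; $\sqsubseteq$ inclusion, $\sqcup$ union; $\mathrm{dom}\,\alpha=\{(x,x)\mid\exists y.\,(x,y)\in\alpha\}$; a pfn (partial function) is a univalent relation. For $f:Y\rightharpoonup\wp(Z)$, $(B,A)\in f_\circ$ iff $A=\bigcup\{C\mid\exists b\in B.\,(b,C)\in f\}$. For $v\sqsubseteq\mathrm{id}_Y$, $\hat u_v=\{(A,A)\mid A\subseteq Y,\ \forall a\in A.\,(a,a)\in v\}$. $f\sqsubseteq_c\beta$ means $f\sqsubseteq\beta$, $f$ a pfn, $\mathrm{dom}\,f=\mathrm{dom}\,\beta$. Peleg lifting: $\beta_*=\bigsqcup_{f\sqsubseteq_c\beta}\hat u_{\mathrm{dom}\,\beta}f_\circ$ (set-theoretically, $(B,A)\in\beta_*$ iff there is a function $h$ on $B$ with $(b,h(b))\in\beta$ for all $b\in B$ and $A=\bigcup_{b\in B}h(b)$). Peleg composition: $\alpha*\beta=\alpha\beta_*$. -}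

module Defs where

open import Level using (Level; 0ℓ; _⊔_) renaming (suc to lsuc)
open import Data.Product using (Σ; _×_; Σ-syntax)
open import Relation.Unary using (Pred; _≐_)
open import Relation.Binary using (REL)

-- ℘ Y : subsets of Y (as predicates); equality of subsets is extensional (_≐_).
℘ : Set → Set₁
℘ Y = Pred Y 0ℓ

IsPfn : {ℓ : Level} {Y Z : Set} → REL Y (℘ Z) ℓ → Set (lsuc 0ℓ ⊔ ℓ)
IsPfn {Y = Y} f = ∀ (y : Y) C D → f y C → f y D → C ≐ D

⋃ : {Y Z : Set} (B : ℘ Y) → ((b : Y) → B b → ℘ Z) → ℘ Z
⋃ {Y} B h z = Σ[ b ∈ Y ] Σ[ p ∈ B b ] h b p z

lift : {ℓ : Level} {Y Z : Set} → REL Y (℘ Z) ℓ → REL (℘ Y) (℘ Z) (lsuc 0ℓ ⊔ ℓ)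
lift {Y = Y} {Z} β B A =
  Σ[ h ∈ ((b : Y) → B b → ℘ Z) ] (((b : Y) (p : B b) → β b (h b p)) × (A ≐ ⋃ B h))

_✶_ : {ℓ₁ ℓ₂ : Level} {X Y Z : Set} → REL X (℘ Y) ℓ₁ → REL Y (℘ Z) ℓ₂ → REL X (℘ Z) (lsuc 0ℓ ⊔ ℓ₁ ⊔ ℓ₂)
_✶_ {Y = Y} α β x C = Σ[ B ∈ ℘ Y ] (α x B × lift β B C)

_≡ᴿ_ : {a b ℓ₁ ℓ₂ : Level} {A : Set a} {B : Set b} → REL A B ℓ₁ → REL A B ℓ₂ → Set (a ⊔ b ⊔ ℓ₁ ⊔ ℓ₂)
R ≡ᴿ S = (∀ a b → R a b → S a b) × (∀ a b → S a b → R a b)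

-- Writing (α ✶ β) ✶ g as α β_* g_* and α ✶ (β ✶ g) as α (β g_*)_*, it suffices to show
-- (β ✶ g)_* = β_* g_*. Both sides describe a set D as a union over b ∈ B of unions over
-- z ∈ h(b) of k(z), once grouped as ⋃_{z ∈ ⋃_b h(b)} k(z) and once as ⋃_b ⋃_{z ∈ h(b)} k(z).
module Submission where

open import Defs
open import Level using (Level)
open import Relation.Binary using (REL)
open import Relation.Unary using (_≐_)
open import Relation.Unary.Properties using (≐-refl; ≐-sym; ≐-trans)
open import Data.Product using (Σ-syntax; _×_; _,_; proj₁; proj₂)

⋃-⋃ : {Y Z W : Set} (B : ℘ Y) (h : (b : Y) → B b → ℘ Z) (k : (z : Z) → ⋃ B h z → ℘ W) →
      ⋃ (⋃ B h) k ≐ ⋃ B (λ b p → ⋃ (h b p) (λ z r → k z (b , p , r)))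
⋃-⋃ B h k =
  (λ { (z , (b , p , r) , w∈k) → b , p , z , r , w∈k }) ,
  (λ { (b , p , z , r , w∈k) → z , (b , p , r) , w∈k })

⋃-cong : {Y Z : Set} (B : ℘ Y) {h₁ h₂ : (b : Y) → B b → ℘ Z} →
         (∀ b p → h₁ b p ≐ h₂ b p) → ⋃ B h₁ ≐ ⋃ B h₂
⋃-cong B h₁≐h₂ =
  (λ { (b , p , z∈h₁) → b , p , proj₁ (h₁≐h₂ b p) z∈h₁ }) ,
  (λ { (b , p , z∈h₂) → b , p , proj₂ (h₁≐h₂ b p) z∈h₂ })

-- Families are indexed by membership proofs, so transporting one along C ≐ C′ changes the
-- proof it is applied to; univalence of g makes the result independent of that proof.
lift-respˡ-≐ : {ℓ : Level} {Z W : Set} {g : REL Z (℘ W) ℓ} → IsPfn g →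
               {C C′ : ℘ Z} {D : ℘ W} → C ≐ C′ → lift g C D → lift g C′ D
lift-respˡ-≐ g-pfn {C} {C′} {D} (C⊆C′ , C′⊆C) (k , k∈g , D≐⋃) =
  k′ , (λ z q → k∈g z (C′⊆C q)) , (D⊆⋃ , ⋃⊆D)
  where
  k′ : ∀ z → C′ z → ℘ _
  k′ z q = k z (C′⊆C q)
  D⊆⋃ : ∀ {w} → D w → ⋃ C′ k′ w
  D⊆⋃ w∈D with proj₁ D≐⋃ w∈D
  ... | z , q , w∈k =
    z , C⊆C′ q , proj₁ (g-pfn z _ _ (k∈g z q) (k∈g z (C′⊆C (C⊆C′ q)))) w∈k
  ⋃⊆D : ∀ {w} → ⋃ C′ k′ w → D w
  ⋃⊆D (z , q , w∈k) = proj₂ D≐⋃ (z , C′⊆C q , w∈k)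

lift-✶⇒lift∘lift : {ℓ₂ ℓ₃ : Level} {Y Z W : Set} {β : REL Y (℘ Z) ℓ₂} {g : REL Z (℘ W) ℓ₃}
                   {B : ℘ Y} {D : ℘ W} →
                   lift (β ✶ g) B D → Σ[ C ∈ ℘ Z ] (lift β B C × lift g C D)
lift-✶⇒lift∘lift {g = g} {B} {D} (h′ , h′∈β✶g , D≐⋃) =
  ⋃ B h , (h , (λ b p → proj₁ (proj₂ (h′∈β✶g b p))) , ≐-refl) ,
  (k , k∈g , ≐-trans D≐⋃ (≐-trans (⋃-cong B h′≐⋃k) (≐-sym (⋃-⋃ B h k))))
  where
  h : ∀ b → B b → ℘ _
  h b p = proj₁ (h′∈β✶g b p)
  k : ∀ z → ⋃ B h z → ℘ _
  k z (b , p , r) = proj₁ (proj₂ (proj₂ (h′∈β✶g b p))) z r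
  k∈g : ∀ z (q : ⋃ B h z) → g z (k z q)
  k∈g z (b , p , r) = proj₁ (proj₂ (proj₂ (proj₂ (h′∈β✶g b p)))) z r
  h′≐⋃k : ∀ b p → h′ b p ≐ ⋃ (h b p) (λ z r → k z (b , p , r))
  h′≐⋃k b p = proj₂ (proj₂ (proj₂ (proj₂ (h′∈β✶g b p))))

lift∘lift⇒lift-✶ : {ℓ₂ ℓ₃ : Level} {Y Z W : Set} {β : REL Y (℘ Z) ℓ₂} {g : REL Z (℘ W) ℓ₃} →
                   IsPfn g → {B : ℘ Y} {C : ℘ Z} {D : ℘ W} →
                   lift β B C → lift g C D → lift (β ✶ g) B D
lift∘lift⇒lift-✶ g-pfn {B} (h , h∈β , C≐⋃) C↦D
  with lift-respˡ-≐ g-pfn C≐⋃ C↦D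
... | k , k∈g , D≐⋃ =
  (λ b p → ⋃ (h b p) (λ z r → k z (b , p , r))) ,
  (λ b p → h b p , h∈β b p , (λ z r → k z (b , p , r)) , (λ z r → k∈g z (b , p , r)) , ≐-refl) ,
  ≐-trans D≐⋃ (⋃-⋃ B h k)

proposition7p8 : {ℓ₁ ℓ₂ ℓ₃ : Level} {X Y Z W : Set}
    (α : REL X (℘ Y) ℓ₁) (β : REL Y (℘ Z) ℓ₂) (g : REL Z (℘ W) ℓ₃) →
    IsPfn g →
    ((α ✶ β) ✶ g) ≡ᴿ (α ✶ (β ✶ g))
proposition7p8 α β g g-pfn =
  (λ { x D (C , (B , B∈αx , B↦C) , C↦D) → B , B∈αx , lift∘lift⇒lift-✶ {β = β} g-pfn B↦C C↦D }) ,
  (λ { x D (B , B∈αx , B↦D) → let (C , B↦C , C↦D) = lift-✶⇒lift∘lift {β = β} {g} B↦D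
                              in C , (B , B∈αx , B↦C) , C↦D })
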